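{- Let $G$ be a $d$-regular graph and $v$ a vertex of $G$; layer $G$ from $v$ and let $\ell=|V_2|$. Suppose that $G[V_2]$ is complete, $2\leq\ell\leq d-1$, every $u\in V_2$ has $\mathrm{id}(u)=1$, and $V_3\neq\emptyset$. If $V_4\neq\emptyset$, then there is a $\Delta^+$-switch transforming $G$ into a graph $G'$ such that ${\rm N}_{G'}(v)={\rm N}_G(v)$, the edges of $G[V_1]$ are unaltered, and $G'$ contains two non-adjacent vertices both at distance $2$ from $v$ (i.e. a non-edge is created in the second layer).
   Context: All graphs are simple. Layering from $v$: let $C$ be the component containing $v$; for $i\ge0$, $V_i$ is the set of vertices of $C$ at distance exactly $i$ from $v$ (so $V_1={\rm N}(v)$). For $u\in V_i$, $\mathrm{id}(u)=|{\rm N}(u)\cap V_{i-1}|$. A $\Delta^+$-switch: if $p,x,y,w,z$ are distinct vertices with $yx, xp, pw, wz\in E$ and $xw, yz\notin E$, delete $xy$, $wz$ and insert $xw$, $yz$. -}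

module Defs where

open import Data.Nat using (ℕ; zero; suc; _<_)
open import Data.Fin using (Fin)
open import Data.Bool using (Bool; true; false)
open import Data.List using (List; length)
open import Data.List.Membership.Propositional using (_∈_)
open import Data.List.Relation.Unary.Unique.Propositional using (Unique)
open import Data.Product using (Σ; _×_; ∃)
open import Data.Sum using (_⊎_)
open import Relation.Nullary using (¬_)
open import Relation.Binary.PropositionalEquality using (_≡_; _≢_)
open import Function.Bundles using (_⇔_)

record Graph (n : ℕ) : Set where
  field
    adj   : Fin n → Fin n → Bool
    sym   : ∀ a b → adj a b ≡ adj b a
    irrefl : ∀ a → adj a a ≡ false

open Graph public

Edge : ∀ {n} → Graph n → Fin n → Fin n → Set
Edge G a b = adj G a b ≡ true

HasSize : ∀ {n} → (Fin n → Set) → ℕ → Set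
HasSize {n} P k = Σ (List (Fin n)) λ L → length L ≡ k × Unique L × (∀ x → (x ∈ L) ⇔ P x)

Regular : ∀ {n} → Graph n → ℕ → Set
Regular G d = ∀ u → HasSize (Edge G u) d

data Walk {n} (G : Graph n) : Fin n → Fin n → ℕ → Set where
  nil  : ∀ {a} → Walk G a a 0
  cons : ∀ {a c b k} → Edge G a c → Walk G c b k → Walk G a b (suc k)

-- Dist G v u i : u is at distance exactly i from v (so u ∈ V_i of the layering from v).
Dist : ∀ {n} → Graph n → Fin n → Fin n → ℕ → Set
Dist G v u i = Walk G v u i × (∀ j → j < i → ¬ Walk G v u j)

SamePair : ∀ {n} → Fin n → Fin n → Fin n → Fin n → Set
SamePair a b c d = (a ≡ c × b ≡ d) ⊎ (a ≡ d × b ≡ c)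

IsSwitch : ∀ {n} → Graph n → Graph n → (p x y w z : Fin n) → Set
IsSwitch G G' p x y w z =
  (p ≢ x × p ≢ y × p ≢ w × p ≢ z × x ≢ y × x ≢ w × x ≢ z × y ≢ w × y ≢ z × w ≢ z)
  × Edge G y x × Edge G x p × Edge G p w × Edge G w z
  × ¬ Edge G x w × ¬ Edge G y z
  × (∀ a b → Edge G' a b ⇔
        ((Edge G a b × ¬ SamePair a b x y × ¬ SamePair a b w z)
          ⊎ SamePair a b x w ⊎ SamePair a b y z))

-- Take w ∈ V₄ on a shortest path v a x p w, so x ∈ V₂ and p ∈ V₃, and any other y ∈ V₂;
-- xy is an edge because V₂ is a clique. Some neighbour z ≠ p of w is not adjacent to y:
-- otherwise N(w), x and the parent of y in V₁ (neither adjacent to w, which is too far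
-- from v) would be d + 2 distinct vertices in {p} ∪ N(y). The switch of xy, wz for xw, yz
-- only touches vertices outside V₀ ∪ V₁, so N(v), the edges inside V₁ and the layer V₂
-- are unchanged, while xy becomes a non-edge inside V₂.

module Submission where

open import Defs
open import Data.Nat using (ℕ; _≤_; _∸_; zero; suc; _<_; z≤n; s≤s; z<s; s<s)
open import Data.Nat.Properties using (<-≤-trans; 1+n≰n)
open import Data.Fin using (Fin; _≟_)
import Data.Bool as Bool
open import Data.List using (List; []; _∷_; length)
open import Data.List.Membership.Propositional using (_∈_; find; lose)
open import Data.List.Relation.Unary.Any using (here; there; any?)
open import Data.List.Relation.Unary.All as All using (_∷_)
open import Data.List.Relation.Unary.AllPairs using (_∷_)
open import Data.List.Relation.Unary.Unique.Propositional using (Unique)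
open import Data.List.Relation.Binary.Subset.Propositional using (_⊆_)
open import Data.Product using (Σ; _×_; ∃; _,_; proj₁; proj₂)
open import Data.Sum using (_⊎_; inj₁; inj₂)
import Data.Sum as Sum
open import Function using (const; _∘_; case_of_)
open import Relation.Nullary using (¬_; Dec; yes; no; does; ¬?; contradiction)
open import Relation.Nullary.Decidable using (_×-dec_; _⊎-dec_; dec-false; does-⇔)
open import Relation.Binary.PropositionalEquality using (_≡_; _≢_; refl; trans; cong; subst; subst₂; ≢-sym)
import Relation.Binary.PropositionalEquality as Eq
open import Relation.Binary.Definitions using (DecidableEquality)
open import Function.Bundles using (_⇔_; mk⇔; Equivalence)

remove-∈ : ∀ {A : Set} {m : A} {ys : List A} → m ∈ ys →
  Σ (List A) λ ys′ → length ys ≡ suc (length ys′) × (∀ {q} → q ∈ ys → q ≡ m ⊎ q ∈ ys′)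
remove-∈ {ys = y ∷ ys} (here refl) = ys , refl , λ { (here eq) → inj₁ eq ; (there q∈) → inj₂ q∈ }
remove-∈ {ys = y ∷ ys} (there m∈) with remove-∈ m∈
... | ys′ , len , split = y ∷ ys′ , cong suc len ,
      λ { (here eq) → inj₂ (here eq) ; (there q∈) → Sum.map₂ there (split q∈) }

Unique-⊆⇒length≤ : ∀ {A : Set} {xs ys : List A} → Unique xs → xs ⊆ ys → length xs ≤ length ys
Unique-⊆⇒length≤ {xs = []} _ _ = z≤n
Unique-⊆⇒length≤ {xs = x ∷ xs} (x∉xs ∷ uxs) xs⊆ys with remove-∈ (xs⊆ys (here refl))
... | ys′ , len , split = subst (suc (length xs) ≤_) (Eq.sym len) (s≤s (Unique-⊆⇒length≤ uxs xs⊆ys′))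
  where
  xs⊆ys′ : xs ⊆ ys′
  xs⊆ys′ q∈ with split (xs⊆ys (there q∈))
  ... | inj₁ refl = contradiction refl (All.lookup x∉xs q∈)
  ... | inj₂ q∈′ = q∈′

Unique⇒∃≢ : ∀ {A : Set} {xs : List A} → DecidableEquality A → Unique xs → 2 ≤ length xs →
  ∀ x → ∃ λ y → y ∈ xs × y ≢ x
Unique⇒∃≢ {xs = a ∷ b ∷ _} _≟_ ((a≢b ∷ _) ∷ _) _ x with a ≟ x
... | yes refl = b , there (here refl) , λ b≡a → a≢b (Eq.sym b≡a)
... | no a≢x = a , here refl , a≢x
Unique⇒∃≢ {xs = _ ∷ []} _ _ (s≤s ()) _

HasSize⇒∃≢ : ∀ {n} {P : Fin n → Set} {k} → HasSize P k → 2 ≤ k → ∀ x → ∃ λ y → P y × y ≢ x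
HasSize⇒∃≢ (xs , refl , unique , mem) 2≤k x with Unique⇒∃≢ _≟_ unique 2≤k x
... | y , y∈xs , y≢x = y , Equivalence.to (mem y) y∈xs , y≢x

module _ {n} (G : Graph n) where

  Edge-sym : ∀ {a b} → Edge G a b → Edge G b a
  Edge-sym {a} {b} e = trans (Graph.sym G b a) e

  Edge⇒≢ : ∀ {a b} → Edge G a b → a ≢ b
  Edge⇒≢ {a} e refl with trans (Eq.sym e) (Graph.irrefl G a)
  ... | ()

  Edge? : ∀ a b → Dec (Edge G a b)
  Edge? a b = adj G a b Bool.≟ Bool.true

module _ {n} {G : Graph n} where

  snoc : ∀ {a b c k} → Walk G a b k → Edge G b c → Walk G a c (suc k)
  snoc nil e = cons e nil
  snoc (cons e w) e′ = cons e (snoc w e′)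

Beyond : ∀ {n} → Graph n → Fin n → ℕ → Fin n → Set
Beyond G v k u = ∀ j → j < k → ¬ Walk G v u j

module _ {n} {G : Graph n} {v : Fin n} where

  Beyond-≢ : ∀ {k u a j} → Beyond G v k u → Walk G v a j → j < k → a ≢ u
  Beyond-≢ far w lt refl = far _ lt w

  Beyond-mono : ∀ {k k′ u} → k′ ≤ k → Beyond G v k u → Beyond G v k′ u
  Beyond-mono k′≤k far j lt = far j (<-≤-trans lt k′≤k)

  Beyond-neighbour : ∀ {k u t} → Beyond G v (suc k) u → Edge G t u → Beyond G v k t
  Beyond-neighbour far e j lt w = far (suc j) (s≤s lt) (snoc w e)

  Beyond-¬Edge : ∀ {k u a j} → Beyond G v (suc k) u → Walk G v a j → j < k → ¬ Edge G a u
  Beyond-¬Edge far w lt e = Beyond-≢ (Beyond-neighbour far e) w lt refl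

  Dist₂-transfer : ∀ {H : Graph n} →
    (∀ {a j} b → Walk G v a j → j < 2 → Edge H a b ⇔ Edge G a b) →
    ∀ {u} → Dist G v u 2 → Dist H v u 2
  Dist₂-transfer {H} agree (cons e₁ (cons e₂ nil) , far) =
    cons (from nil z<s e₁) (cons (from (cons e₁ nil) (s<s z<s) e₂) nil) , far′
    where
    from : ∀ {a j b} → Walk G v a j → j < 2 → Edge G a b → Edge H a b
    from w lt = Equivalence.from (agree _ w lt)
    far′ : Beyond H v 2 _
    far′ zero _ nil = far 0 z<s nil
    far′ (suc zero) _ (cons e nil) = far 1 (s<s z<s) (cons (Equivalence.to (agree _ nil z<s) e) nil)
    far′ (suc (suc _)) (s<s (s<s ())) _

Regular⇒escaping-neighbour : ∀ {n} (G : Graph n) {d} → Regular G d →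
  ∀ y w p {a b} → a ≢ b → Edge G y a → Edge G y b → ¬ Edge G w a → ¬ Edge G w b →
  ∃ λ z → Edge G w z × z ≢ p × ¬ Edge G y z
Regular⇒escaping-neighbour G regular y w p {a} {b} a≢b ya yb ¬wa ¬wb
  with regular w | regular y
... | Nw , |Nw| , uniqueNw , memNw | Ny , |Ny| , _ , memNy
  with any? (λ z → ¬? (z ≟ p) ×-dec ¬? (Edge? G y z)) Nw
... | yes escaping = let z , z∈Nw , z≢p , ¬yz = find escaping in
      z , Equivalence.to (memNw z) z∈Nw , z≢p , ¬yz
... | no ¬escaping = contradiction (subst₂ (λ s t → suc (suc s) ≤ suc t) |Nw| |Ny| counting) 1+n≰n
  where
  ∉Nw : ∀ {c} → ¬ Edge G w c → All.All (c ≢_) Nw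
  ∉Nw ¬wc = All.tabulate λ c∈ → λ { refl → ¬wc (Equivalence.to (memNw _) c∈) }
  into : a ∷ b ∷ Nw ⊆ p ∷ Ny
  into (here refl) = there (Equivalence.from (memNy a) ya)
  into (there (here refl)) = there (Equivalence.from (memNy b) yb)
  into {q} (there (there q∈)) with q ≟ p | Edge? G y q
  ... | yes refl | _ = here refl
  ... | no _ | yes yq = there (Equivalence.from (memNy q) yq)
  ... | no q≢p | no ¬yq = contradiction (lose q∈ (q≢p , ¬yq)) ¬escaping
  counting : suc (suc (length Nw)) ≤ suc (length Ny)
  counting = Unique-⊆⇒length≤ ((a≢b ∷ ∉Nw ¬wa) ∷ ∉Nw ¬wb ∷ uniqueNw) into

does≡true⇔ : ∀ {A : Set} (a? : Dec A) → does a? ≡ Bool.true ⇔ A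
does≡true⇔ (yes a) = mk⇔ (const a) (const refl)
does≡true⇔ (no ¬a) = mk⇔ (λ ()) (λ a → contradiction a ¬a)

module _ {n} {a b c d : Fin n} where

  SamePair-swap : SamePair a b c d → SamePair b a c d
  SamePair-swap = Sum.[ (λ (a≡c , b≡d) → inj₂ (b≡d , a≡c)) , (λ (a≡d , b≡c) → inj₁ (b≡c , a≡d)) ]

  SamePair-≢ : a ≢ c → a ≢ d → ¬ SamePair a b c d
  SamePair-≢ a≢c a≢d = Sum.[ a≢c ∘ proj₁ , a≢d ∘ proj₁ ]

  SamePair-diagonal : a ≡ b → SamePair a b c d → c ≡ d
  SamePair-diagonal refl = Sum.[ (λ (a≡c , a≡d) → trans (Eq.sym a≡c) a≡d) , (λ (a≡d , a≡c) → trans (Eq.sym a≡c) a≡d) ]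

SamePair? : ∀ {n} (a b c d : Fin n) → Dec (SamePair a b c d)
SamePair? a b c d = (a ≟ c ×-dec b ≟ d) ⊎-dec (a ≟ d ×-dec b ≟ c)

module Switch {n} (G : Graph n) (x y w z : Fin n) where

  SwitchEdge : Fin n → Fin n → Set
  SwitchEdge a b = (Edge G a b × ¬ SamePair a b x y × ¬ SamePair a b w z)
                   ⊎ SamePair a b x w ⊎ SamePair a b y z

  SwitchEdge? : ∀ a b → Dec (SwitchEdge a b)
  SwitchEdge? a b = (Edge? G a b ×-dec ¬? (SamePair? a b x y) ×-dec ¬? (SamePair? a b w z))
                    ⊎-dec SamePair? a b x w ⊎-dec SamePair? a b y z

  SwitchEdge-sym : ∀ {a b} → SwitchEdge a b → SwitchEdge b a
  SwitchEdge-sym = Sum.map (λ (e , ¬xy , ¬wz) → Edge-sym G e , ¬xy ∘ SamePair-swap , ¬wz ∘ SamePair-swap)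
                           (Sum.map SamePair-swap SamePair-swap)

  module _ (x≢w : x ≢ w) (y≢z : y ≢ z) where

    ¬SwitchEdge-loop : ∀ a → ¬ SwitchEdge a a
    ¬SwitchEdge-loop a (inj₁ (e , _)) = Edge⇒≢ G e refl
    ¬SwitchEdge-loop a (inj₂ (inj₁ xw)) = x≢w (SamePair-diagonal refl xw)
    ¬SwitchEdge-loop a (inj₂ (inj₂ yz)) = y≢z (SamePair-diagonal refl yz)

    switched : Graph n
    switched = record
      { adj = λ a b → does (SwitchEdge? a b)
      ; sym = λ a b → does-⇔ (mk⇔ SwitchEdge-sym SwitchEdge-sym) (SwitchEdge? a b) (SwitchEdge? b a)
      ; irrefl = λ a → dec-false (SwitchEdge? a a) (¬SwitchEdge-loop a)
      }

    switched-Edge : ∀ a b → Edge switched a b ⇔ SwitchEdge a b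
    switched-Edge a b = does≡true⇔ (SwitchEdge? a b)

    switched-Edge-untouched : ∀ {a} → a ≢ x → a ≢ y → a ≢ w → a ≢ z → ∀ b → Edge switched a b ⇔ Edge G a b
    switched-Edge-untouched a≢x a≢y a≢w a≢z b = mk⇔
      (λ e → case Equivalence.to (switched-Edge _ b) e of λ where
        (inj₁ (e , _)) → e
        (inj₂ (inj₁ xw)) → contradiction xw (SamePair-≢ a≢x a≢w)
        (inj₂ (inj₂ yz)) → contradiction yz (SamePair-≢ a≢y a≢z))
      (λ e → Equivalence.from (switched-Edge _ b) (inj₁ (e , SamePair-≢ a≢x a≢y , SamePair-≢ a≢w a≢z)))

    switched-¬Edge : y ≢ w → x ≢ z → ¬ Edge switched x y
    switched-¬Edge y≢w x≢z e with Equivalence.to (switched-Edge x y) e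
    ... | inj₁ (_ , ¬xy , _) = ¬xy (inj₁ (refl , refl))
    ... | inj₂ (inj₁ xw) = Sum.[ y≢w ∘ proj₂ , x≢w ∘ proj₁ ] xw
    ... | inj₂ (inj₂ yz) = Sum.[ y≢z ∘ proj₂ , x≢z ∘ proj₁ ] yz

SplittingSwitch : ∀ {n} → Graph n → Fin n → Set
SplittingSwitch {n} G v = Σ (Graph n) λ G′ → ∃ λ p → ∃ λ x → ∃ λ y → ∃ λ w → ∃ λ z →
  IsSwitch G G′ p x y w z
  × (∀ u → Edge G′ v u ⇔ Edge G v u)
  × (∀ a b → Dist G v a 1 → Dist G v b 1 → (Edge G′ a b ⇔ Edge G a b))
  × (∃ λ a → ∃ λ b → a ≢ b × ¬ Edge G′ a b × Dist G′ v a 2 × Dist G′ v b 2)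

splitting-switch : ∀ {n} {G : Graph n} {v x y p w z} →
  Dist G v x 2 → Dist G v y 2 → x ≢ y → Edge G y x → Edge G x p → Edge G p w → Beyond G v 4 w →
  Edge G w z → z ≢ p → ¬ Edge G y z → SplittingSwitch G v
splitting-switch {G = G} {v} {x} {y} {p} {w} {z}
  dx@(vx , beyond-x) dy@(vy , beyond-y) x≢y yx xp pw beyond-w wz z≢p ¬yz =
  switched x≢w y≢z , p , x , y , w , z ,
  ( ( ≢-sym (Edge⇒≢ G xp) , ≢-sym (Beyond-≢ beyond-p vy (s<s (s<s z<s))) , Edge⇒≢ G pw , ≢-sym z≢p
    , x≢y , x≢w , Beyond-≢ beyond-z vx (s<s (s<s z<s)) , y≢w , y≢z , Edge⇒≢ G wz )
  , yx , xp , pw , wz , Beyond-¬Edge beyond-w vx (s<s (s<s z<s)) , ¬yz , switched-Edge x≢w y≢z )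
  , (λ u → near u nil z<s)
  , (λ a b (va , _) _ → near b va (s<s z<s))
  , x , y , x≢y , switched-¬Edge x≢w y≢z y≢w (Beyond-≢ beyond-z vx (s<s (s<s z<s)))
  , Dist₂-transfer near dx , Dist₂-transfer near dy
  where
  open Switch G x y w z
  beyond-p : Beyond G v 3 p
  beyond-p = Beyond-neighbour beyond-w pw
  beyond-z : Beyond G v 3 z
  beyond-z = Beyond-neighbour beyond-w (Edge-sym G wz)
  x≢w : x ≢ w
  x≢w = Beyond-≢ beyond-w vx (s<s (s<s z<s))
  y≢w : y ≢ w
  y≢w = Beyond-≢ beyond-w vy (s<s (s<s z<s))
  y≢z : y ≢ z
  y≢z = Beyond-≢ beyond-z vy (s<s (s<s z<s))
  near : ∀ {a j} b → Walk G v a j → j < 2 → Edge (switched x≢w y≢z) a b ⇔ Edge G a b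
  near b va j<2 = switched-Edge-untouched x≢w y≢z
    (Beyond-≢ beyond-x va j<2) (Beyond-≢ beyond-y va j<2)
    (Beyond-≢ (Beyond-mono (s≤s (s≤s z≤n)) beyond-w) va j<2)
    (Beyond-≢ (Beyond-mono (s≤s (s≤s z≤n)) beyond-z) va j<2) b

V₄⇒splitting-switch : ∀ {n} {G : Graph n} {d v x p w} → Regular G d →
  (∀ a b → Dist G v a 2 → Dist G v b 2 → a ≢ b → Edge G a b) →
  (∃ λ y → Dist G v y 2 × y ≢ x) →
  Walk G v x 2 → Edge G x p → Edge G p w → Beyond G v 4 w → SplittingSwitch G v
V₄⇒splitting-switch {G = G} {v = v} {x = x} {p = p} {w = w} regular V₂-clique
  (y , dy@(cons {c = b} vb (cons by nil) , _) , y≢x) vx xp pw beyond-w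
  = let z , wz , z≢p , ¬yz = Regular⇒escaping-neighbour G regular y w p x≢b yx (Edge-sym G by)
          (Beyond-¬Edge beyond-w vx (s<s (s<s z<s)) ∘ Edge-sym G)
          (Beyond-¬Edge beyond-w (cons vb nil) (s<s z<s) ∘ Edge-sym G)
    in splitting-switch dx dy (≢-sym y≢x) yx xp pw beyond-w wz z≢p ¬yz
  where
  dx : Dist G v x 2
  dx = vx , Beyond-neighbour (Beyond-neighbour beyond-w pw) xp
  yx : Edge G y x
  yx = V₂-clique y x dy dx y≢x
  x≢b : x ≢ b
  x≢b = ≢-sym (Beyond-≢ (proj₂ dx) (cons vb nil) (s<s z<s))

lemma3p8 : ∀ {n} (G : Graph n) (d : ℕ) (v : Fin n) (ℓ : ℕ) →
    Regular G d →
    HasSize (λ u → Dist G v u 2) ℓ →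
    (∀ a b → Dist G v a 2 → Dist G v b 2 → a ≢ b → Edge G a b) →
    2 ≤ ℓ → ℓ ≤ d ∸ 1 →
    (∀ u → Dist G v u 2 → HasSize (λ w → Edge G u w × Dist G v w 1) 1) →
    (∃ λ u → Dist G v u 3) →
    (∃ λ u → Dist G v u 4) →
    Σ (Graph n) λ G' → ∃ λ p → ∃ λ x → ∃ λ y → ∃ λ w → ∃ λ z →
    IsSwitch G G' p x y w z
    × (∀ u → Edge G' v u ⇔ Edge G v u)
    × (∀ a b → Dist G v a 1 → Dist G v b 1 → (Edge G' a b ⇔ Edge G a b))
    × (∃ λ a → ∃ λ b → a ≢ b × ¬ Edge G' a b × Dist G' v a 2 × Dist G' v b 2)
lemma3p8 G d v ℓ regular V₂-size V₂-clique 2≤ℓ _ _ _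
  (w , cons va (cons {c = x} ax (cons xp (cons pw nil))) , beyond-w) =
  V₄⇒splitting-switch regular V₂-clique (HasSize⇒∃≢ V₂-size 2≤ℓ x) (cons va (cons ax nil)) xp pw beyond-w
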